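{- Let $a,b\geq 3$ and let $h_1,h_2,h_3$ be positive integers (not necessarily in non-increasing order). An $\mathrm{ROS}(h_1h_2^ah_3^b)$ exists if and only if all of the following hold: (1) $(a-1)h_2+bh_3\geq h_1$; (2) $(b-1)h_3+ah_2\geq h_1$; (3) $a(a-1)h_2^2\geq ah_1h_2-bh_1h_3$; (4) $b(b-1)h_3^2\geq bh_1h_3-ah_1h_2$; (5) $a(a-1)h_2^2+b(b-1)h_3^2\geq abh_2h_3-2ah_1h_2+bh_1h_3$; (6) $a(a-1)h_2^2+b(b-1)h_3^2\geq abh_2h_3-2bh_1h_3+ah_1h_2$.
   Context: Given a sequence $P=(p_1,\dots,p_k)$ of positive integers, an $\mathrm{ROS}(P)$ (symmetric rational outline square respecting $P$) is an assignment of a non-negative rational number $O(i,j,\ell)$ to every multiset $\{i,j,\ell\}$ of elements of $[k]=\{1,\dots,k\}$ (so the value is invariant under permuting $i,j,\ell$) such that $\sum_{\ell\in[k]}O(i,j,\ell)=p_ip_j$ for all $i,j\in[k]$, and $O(i,i,i)=p_i^2$ and $O(i,i,j)=0$ for all $i\neq j$. The notation $h^m$ means $m$ parts equal to $h$; so $(h_1h_2^ah_3^b)$ has $1+a+b$ entries. -}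

module Defs where

open import Data.Nat as ℕ using (ℕ; _≤ᵇ_; _≡ᵇ_)
open import Data.Fin using (Fin; toℕ; zero; suc)
open import Data.Bool using (if_then_else_)
open import Data.Integer as ℤ using (ℤ)
open import Data.Rational as ℚ using (ℚ; 0ℚ)
open import Data.Product using (_×_)
open import Relation.Binary.PropositionalEquality using (_≡_; _≢_)

Σℚ : ∀ {k} → (Fin k → ℚ) → ℚ
Σℚ {ℕ.zero}  f = 0ℚ
Σℚ {ℕ.suc k} f = f zero ℚ.+ Σℚ (λ i → f (suc i))

ℕ→ℚ : ℕ → ℚ
ℕ→ℚ n = ℚ._/_ (ℤ.+ n) 1

-- A symmetric rational outline square respecting P = (p_1,…,p_k).
-- The multiset-indexed function O is encoded as a function on ordered
-- triples invariant under all permutations of its arguments.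
record ROS (k : ℕ) (p : Fin k → ℕ) : Set where
  field
    O        : Fin k → Fin k → Fin k → ℚ
    sym₁₂    : ∀ i j l → O i j l ≡ O j i l
    sym₂₃    : ∀ i j l → O i j l ≡ O i l j
    nonneg   : ∀ i j l → 0ℚ ℚ.≤ O i j l
    lineSum  : ∀ i j → Σℚ (λ l → O i j l) ≡ ℕ→ℚ (p i ℕ.* p j)
    diag     : ∀ i → O i i i ≡ ℕ→ℚ (p i ℕ.* p i)
    offDiag  : ∀ i j → i ≢ j → O i i j ≡ 0ℚ

-- The sequence (h₁ h₂^a h₃^b) of length 1 + a + b:
-- index 0 ↦ h₁, indices 1..a ↦ h₂, indices a+1..a+b ↦ h₃.
seq3 : (h₁ h₂ h₃ a b : ℕ) → Fin (ℕ.suc (a ℕ.+ b)) → ℕ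
seq3 h₁ h₂ h₃ a b i =
  if toℕ i ≡ᵇ 0 then h₁ else (if toℕ i ≤ᵇ a then h₂ else h₃)

{-# OPTIONS --safe #-}
module Submission where

-- Split the indices of (h₁ h₂ᵃ h₃ᵇ) into the blocks {0}, {1,…,a} and {a+1,…,a+b}. Summing the
-- line-sum equations of an ROS over pairs of blocks shows that its totals over the index triples of
-- the seven block types 122, 133, 123, 222, 223, 233, 333 satisfy five linear equations, where the
-- diagonal entries contribute a·h₂² and b·h₃² to the totals of types 222 and 333. Conversely, every
-- nonnegative solution of this system comes from an ROS that is constant on each block type: spread
-- each total evenly over the triples of its type. The solutions are parametrised by the totals Z of
-- type 123 and V of type 223; eliminating V and then Z leaves exactly the six inequalities, and when
-- they hold, Z = min(a h₁h₂, b h₁h₃, ab h₂h₃) together with the largest admissible V is a solution.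

module Criterion where
  open import Data.Bool.Base using (if_then_else_)
  open import Data.Empty using (⊥-elim)
  open import Data.Fin.Base using (Fin; zero; suc; _↑ˡ_; _↑ʳ_; splitAt; toℕ)
  open import Data.Fin.Properties
    using (suc-injective; splitAt-↑ˡ; splitAt-↑ʳ; splitAt⁻¹-↑ˡ; splitAt⁻¹-↑ʳ; toℕ-↑ˡ; toℕ-↑ʳ; toℕ<n)
  import Data.Fin.Properties as Fin
  open import Data.Integer.Base as ℤ using (ℤ)
  import Data.Integer.Properties as ℤ
  open import Data.List.Base using (_∷_; [])
  open import Data.Maybe.Base using (Maybe; just; nothing; maybe′)
  open import Data.Nat.Base as ℕ using (ℕ; z≤n; s≤s)
  import Data.Nat.Properties as ℕ
  open import Data.Product.Base using (_×_; _,_; proj₁; proj₂; ∃₂)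
  open import Data.Rational.Base as ℚ
    using (ℚ; 0ℚ; 1ℚ; _+_; _*_; _-_; -_; _≤_; _<_; _⊓_; _÷_; 1/_; positive; nonNegative; toℚᵘ)
  import Data.Rational.Properties as ℚ
  open import Data.Rational.Unnormalised.Base as ℚᵘ using (mkℚᵘ; *≡*; *≤*; _≃_)
  import Data.Rational.Unnormalised.Properties as ℚᵘ
  open import Data.Sum.Base using (inj₁; inj₂; [_,_]′)
  open import Data.Vec.Base using (Vec; lookup; map) renaming (_∷_ to _∷ᵥ_; [] to []ᵥ)
  open import Data.Vec.Properties using (lookup-map)
  open import Function.Base using (_∘_; const)
  open import Function.Bundles using (_⇔_; mk⇔; Equivalence)
  open import Level using (0ℓ)
  open import Relation.Binary.PropositionalEquality
  open import Relation.Nullary.Decidable using (Dec; does; yes; no; dec-true; dec-false)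
  open import Relation.Nullary.Decidable.Core using (dec⇒maybe)
  open import Relation.Nullary.Negation using (¬_)
  open import Tactic.RingSolver using (solve)
  open import Tactic.RingSolver.Core.AlmostCommutativeRing using (AlmostCommutativeRing; fromCommutativeRing)

  open import Defs

  -- Without the zero test the solver cannot cancel terms such as p + q - q.
  ℚ-ring : AlmostCommutativeRing 0ℓ 0ℓ
  ℚ-ring = fromCommutativeRing ℚ.+-*-commutativeRing (λ p → dec⇒maybe (0ℚ ℚ.≟ p))

  ℤ→ℚ : ℤ → ℚ
  ℤ→ℚ i = i ℚ./ 1

  toℚᵘ-ℤ→ℚ : ∀ i → toℚᵘ (ℤ→ℚ i) ≃ mkℚᵘ i 0
  toℚᵘ-ℤ→ℚ i = ℚ.toℚᵘ-fromℚᵘ (mkℚᵘ i 0)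

  ℤ→ℚ-homo-+ : ∀ i j → ℤ→ℚ (i ℤ.+ j) ≡ ℤ→ℚ i + ℤ→ℚ j
  ℤ→ℚ-homo-+ i j = ℚ.toℚᵘ-injective (begin
    toℚᵘ (ℤ→ℚ (i ℤ.+ j))                  ≈⟨ toℚᵘ-ℤ→ℚ (i ℤ.+ j) ⟩
    mkℚᵘ (i ℤ.+ j) 0                       ≈⟨ *≡* (cong (ℤ._* ℤ.1ℤ) (cong₂ ℤ._+_ (ℤ.*-identityʳ i) (ℤ.*-identityʳ j))) ⟨
    mkℚᵘ i 0 ℚᵘ.+ mkℚᵘ j 0                 ≈⟨ ℚᵘ.+-cong (toℚᵘ-ℤ→ℚ i) (toℚᵘ-ℤ→ℚ j) ⟨
    toℚᵘ (ℤ→ℚ i) ℚᵘ.+ toℚᵘ (ℤ→ℚ j)         ≈⟨ ℚ.toℚᵘ-homo-+ (ℤ→ℚ i) (ℤ→ℚ j) ⟨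
    toℚᵘ (ℤ→ℚ i + ℤ→ℚ j)                   ∎)
    where open ℚᵘ.≃-Reasoning

  ℤ→ℚ-homo-* : ∀ i j → ℤ→ℚ (i ℤ.* j) ≡ ℤ→ℚ i * ℤ→ℚ j
  ℤ→ℚ-homo-* i j = ℚ.toℚᵘ-injective (begin
    toℚᵘ (ℤ→ℚ (i ℤ.* j))                  ≈⟨ toℚᵘ-ℤ→ℚ (i ℤ.* j) ⟩
    mkℚᵘ i 0 ℚᵘ.* mkℚᵘ j 0                 ≈⟨ ℚᵘ.*-cong (toℚᵘ-ℤ→ℚ i) (toℚᵘ-ℤ→ℚ j) ⟨
    toℚᵘ (ℤ→ℚ i) ℚᵘ.* toℚᵘ (ℤ→ℚ j)         ≈⟨ ℚ.toℚᵘ-homo-* (ℤ→ℚ i) (ℤ→ℚ j) ⟨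
    toℚᵘ (ℤ→ℚ i * ℤ→ℚ j)                   ∎)
    where open ℚᵘ.≃-Reasoning

  ℤ→ℚ-homo‿- : ∀ i → ℤ→ℚ (ℤ.- i) ≡ - ℤ→ℚ i
  ℤ→ℚ-homo‿- i = ℚ.toℚᵘ-injective (begin
    toℚᵘ (ℤ→ℚ (ℤ.- i))                    ≈⟨ toℚᵘ-ℤ→ℚ (ℤ.- i) ⟩
    ℚᵘ.- mkℚᵘ i 0                          ≈⟨ ℚᵘ.-‿cong (toℚᵘ-ℤ→ℚ i) ⟨
    ℚᵘ.- toℚᵘ (ℤ→ℚ i)                      ≈⟨ ℚ.toℚᵘ-homo‿- (ℤ→ℚ i) ⟨
    toℚᵘ (- ℤ→ℚ i)                         ∎)
    where open ℚᵘ.≃-Reasoning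

  ℤ→ℚ-mono-≤ : ∀ {i j} → i ℤ.≤ j → ℤ→ℚ i ≤ ℤ→ℚ j
  ℤ→ℚ-mono-≤ {i} {j} i≤j = ℚ.toℚᵘ-cancel-≤ (begin
    toℚᵘ (ℤ→ℚ i)   ≃⟨ toℚᵘ-ℤ→ℚ i ⟩
    mkℚᵘ i 0       ≤⟨ *≤* (ℤ.*-monoʳ-≤-nonNeg ℤ.1ℤ i≤j) ⟩
    mkℚᵘ j 0       ≃⟨ toℚᵘ-ℤ→ℚ j ⟨
    toℚᵘ (ℤ→ℚ j)   ∎)
    where open ℚᵘ.≤-Reasoning

  ℤ→ℚ-cancel-≤ : ∀ {i j} → ℤ→ℚ i ≤ ℤ→ℚ j → i ℤ.≤ j
  ℤ→ℚ-cancel-≤ {i} {j} i≤j with ℚᵘ.≤-respˡ-≃ (toℚᵘ-ℤ→ℚ i) (ℚᵘ.≤-respʳ-≃ (toℚᵘ-ℤ→ℚ j) (ℚ.toℚᵘ-mono-≤ i≤j))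
  ... | *≤* i*1≤j*1 = ℤ.*-cancelʳ-≤-pos i j ℤ.1ℤ i*1≤j*1

  ℕ→ℚ-homo-* : ∀ m n → ℕ→ℚ (m ℕ.* n) ≡ ℕ→ℚ m * ℕ→ℚ n
  ℕ→ℚ-homo-* m n = trans (cong ℤ→ℚ (ℤ.pos-* m n)) (ℤ→ℚ-homo-* (ℤ.+ m) (ℤ.+ n))

  ℕ→ℚ-mono-≤ : ∀ {m n} → m ℕ.≤ n → ℕ→ℚ m ≤ ℕ→ℚ n
  ℕ→ℚ-mono-≤ {m} {n} m≤n = ℤ→ℚ-mono-≤ {ℤ.+ m} {ℤ.+ n} (ℤ.+≤+ m≤n)

  ℕ→ℚ-nonNeg : ∀ n → 0ℚ ≤ ℕ→ℚ n
  ℕ→ℚ-nonNeg n = ℕ→ℚ-mono-≤ {0} {n} z≤n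

  0<ℕ→ℚ : ∀ {n} → 0 ℕ.< n → 0ℚ < ℕ→ℚ n
  0<ℕ→ℚ 0<n = ℚ.<-≤-trans (ℚ.positive⁻¹ 1ℚ) (ℕ→ℚ-mono-≤ 0<n)

  0<ℕ→ℚ-diff : ∀ {k n} → k ℕ.< n → 0ℚ < ℕ→ℚ n - ℕ→ℚ k
  0<ℕ→ℚ-diff {k} {n} k<n = begin-strict
    0ℚ                         <⟨ ℚ.positive⁻¹ 1ℚ ⟩
    1ℚ                         ≡⟨ 1+K-K (ℕ→ℚ k) ⟨
    1ℚ + ℕ→ℚ k - ℕ→ℚ k         ≡⟨ cong (_- ℕ→ℚ k) (ℤ→ℚ-homo-+ (ℤ.+ 1) (ℤ.+ k)) ⟨
    ℕ→ℚ (ℕ.suc k) - ℕ→ℚ k      ≤⟨ ℚ.+-monoˡ-≤ (- ℕ→ℚ k) (ℕ→ℚ-mono-≤ k<n) ⟩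
    ℕ→ℚ n - ℕ→ℚ k              ∎
    where
    open ℚ.≤-Reasoning
    1+K-K : ∀ K → 1ℚ + K - K ≡ 1ℚ
    1+K-K K = solve (K ∷ []) ℚ-ring

  infixl 6 _⊕_ _⊖_
  infixl 7 _⊗_

  data Expr (n : ℕ) : Set where
    var         : Fin n → Expr n
    lit         : ℕ → Expr n
    _⊕_ _⊖_ _⊗_ : Expr n → Expr n → Expr n

  ⟦_⟧ℤ : ∀ {n} → Expr n → Vec ℕ n → ℤ
  ⟦ var i ⟧ℤ ρ = ℤ.+ lookup ρ i
  ⟦ lit k ⟧ℤ ρ = ℤ.+ k
  ⟦ e ⊕ f ⟧ℤ ρ = ⟦ e ⟧ℤ ρ ℤ.+ ⟦ f ⟧ℤ ρ
  ⟦ e ⊖ f ⟧ℤ ρ = ⟦ e ⟧ℤ ρ ℤ.- ⟦ f ⟧ℤ ρ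
  ⟦ e ⊗ f ⟧ℤ ρ = ⟦ e ⟧ℤ ρ ℤ.* ⟦ f ⟧ℤ ρ

  ⟦_⟧ℚ : ∀ {n} → Expr n → Vec ℚ n → ℚ
  ⟦ var i ⟧ℚ σ = lookup σ i
  ⟦ lit k ⟧ℚ σ = ℕ→ℚ k
  ⟦ e ⊕ f ⟧ℚ σ = ⟦ e ⟧ℚ σ + ⟦ f ⟧ℚ σ
  ⟦ e ⊖ f ⟧ℚ σ = ⟦ e ⟧ℚ σ - ⟦ f ⟧ℚ σ
  ⟦ e ⊗ f ⟧ℚ σ = ⟦ e ⟧ℚ σ * ⟦ f ⟧ℚ σ

  ℤ→ℚ-⟦⟧ : ∀ {n} (e : Expr n) ρ → ℤ→ℚ (⟦ e ⟧ℤ ρ) ≡ ⟦ e ⟧ℚ (map ℕ→ℚ ρ)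
  ℤ→ℚ-⟦⟧ (var i) ρ = sym (lookup-map i ℕ→ℚ ρ)
  ℤ→ℚ-⟦⟧ (lit k) ρ = refl
  ℤ→ℚ-⟦⟧ (e ⊕ f) ρ = trans (ℤ→ℚ-homo-+ (⟦ e ⟧ℤ ρ) (⟦ f ⟧ℤ ρ)) (cong₂ _+_ (ℤ→ℚ-⟦⟧ e ρ) (ℤ→ℚ-⟦⟧ f ρ))
  ℤ→ℚ-⟦⟧ (e ⊖ f) ρ = trans (ℤ→ℚ-homo-+ (⟦ e ⟧ℤ ρ) (ℤ.- ⟦ f ⟧ℤ ρ))
    (cong₂ _+_ (ℤ→ℚ-⟦⟧ e ρ) (trans (ℤ→ℚ-homo‿- (⟦ f ⟧ℤ ρ)) (cong -_ (ℤ→ℚ-⟦⟧ f ρ))))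
  ℤ→ℚ-⟦⟧ (e ⊗ f) ρ = trans (ℤ→ℚ-homo-* (⟦ e ⟧ℤ ρ) (⟦ f ⟧ℤ ρ)) (cong₂ _*_ (ℤ→ℚ-⟦⟧ e ρ) (ℤ→ℚ-⟦⟧ f ρ))

  ⟦⟧-≤-ℤ⇔ℚ : ∀ {n} (e f : Expr n) ρ →
             (⟦ e ⟧ℤ ρ ℤ.≤ ⟦ f ⟧ℤ ρ) ⇔ (⟦ e ⟧ℚ (map ℕ→ℚ ρ) ≤ ⟦ f ⟧ℚ (map ℕ→ℚ ρ))
  ⟦⟧-≤-ℤ⇔ℚ e f ρ = mk⇔
    (λ e≤f → subst₂ _≤_ (ℤ→ℚ-⟦⟧ e ρ) (ℤ→ℚ-⟦⟧ f ρ) (ℤ→ℚ-mono-≤ e≤f))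
    (λ e≤f → ℤ→ℚ-cancel-≤ (subst₂ _≤_ (sym (ℤ→ℚ-⟦⟧ e ρ)) (sym (ℤ→ℚ-⟦⟧ f ρ)) e≤f))

  -- The six inequalities, stated once as syntax over the variables a, b, h₁, h₂, h₃ so that
  -- ⟦⟧-≤-ℤ⇔ℚ transfers them between ℤ and ℚ.
  Conditions : (Expr 5 → Expr 5 → Set) → Set
  Conditions _≼_ =
      (h₁ ≼ ((a ⊖ lit 1) ⊗ h₂ ⊕ b ⊗ h₃))
    × (h₁ ≼ ((b ⊖ lit 1) ⊗ h₃ ⊕ a ⊗ h₂))
    × ((a ⊗ h₁ ⊗ h₂ ⊖ b ⊗ h₁ ⊗ h₃) ≼ (a ⊗ (a ⊖ lit 1) ⊗ h₂ ⊗ h₂))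
    × ((b ⊗ h₁ ⊗ h₃ ⊖ a ⊗ h₁ ⊗ h₂) ≼ (b ⊗ (b ⊖ lit 1) ⊗ h₃ ⊗ h₃))
    × ((a ⊗ b ⊗ h₂ ⊗ h₃ ⊖ lit 2 ⊗ a ⊗ h₁ ⊗ h₂ ⊕ b ⊗ h₁ ⊗ h₃)
         ≼ (a ⊗ (a ⊖ lit 1) ⊗ h₂ ⊗ h₂ ⊕ b ⊗ (b ⊖ lit 1) ⊗ h₃ ⊗ h₃))
    × ((a ⊗ b ⊗ h₂ ⊗ h₃ ⊖ lit 2 ⊗ b ⊗ h₁ ⊗ h₃ ⊕ a ⊗ h₁ ⊗ h₂)
         ≼ (a ⊗ (a ⊖ lit 1) ⊗ h₂ ⊗ h₂ ⊕ b ⊗ (b ⊖ lit 1) ⊗ h₃ ⊗ h₃))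
    where
    a b h₁ h₂ h₃ : Expr 5
    a  = var zero
    b  = var (suc zero)
    h₁ = var (suc (suc zero))
    h₂ = var (suc (suc (suc zero)))
    h₃ = var (suc (suc (suc (suc zero))))

  Conditions-⇔ : ∀ {P Q} → (∀ e f → P e f ⇔ Q e f) → Conditions P ⇔ Conditions Q
  Conditions-⇔ P⇔Q = mk⇔
    (λ (c₁ , c₂ , c₃ , c₄ , c₅ , c₆) → to c₁ , to c₂ , to c₃ , to c₄ , to c₅ , to c₆)
    (λ (c₁ , c₂ , c₃ , c₄ , c₅ , c₆) → from c₁ , from c₂ , from c₃ , from c₄ , from c₅ , from c₆)
    where
    to   = λ {e f} → Equivalence.to (P⇔Q e f)
    from = λ {e f} → Equivalence.from (P⇔Q e f)

  Conditionsℤ : (a b h₁ h₂ h₃ : ℕ) → Set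
  Conditionsℤ a b h₁ h₂ h₃ = Conditions (λ e f → ⟦ e ⟧ℤ ρ ℤ.≤ ⟦ f ⟧ℤ ρ)
    where ρ = a ∷ᵥ b ∷ᵥ h₁ ∷ᵥ h₂ ∷ᵥ h₃ ∷ᵥ []ᵥ

  Conditionsℚ : (A B H₁ H₂ H₃ : ℚ) → Set
  Conditionsℚ A B H₁ H₂ H₃ = Conditions (λ e f → ⟦ e ⟧ℚ σ ≤ ⟦ f ⟧ℚ σ)
    where σ = A ∷ᵥ B ∷ᵥ H₁ ∷ᵥ H₂ ∷ᵥ H₃ ∷ᵥ []ᵥ

  Conditionsℤ⇔ℚ : ∀ a b h₁ h₂ h₃ →
    Conditionsℤ a b h₁ h₂ h₃ ⇔ Conditionsℚ (ℕ→ℚ a) (ℕ→ℚ b) (ℕ→ℚ h₁) (ℕ→ℚ h₂) (ℕ→ℚ h₃)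
  Conditionsℤ⇔ℚ a b h₁ h₂ h₃ = Conditions-⇔ (λ e f → ⟦⟧-≤-ℤ⇔ℚ e f (a ∷ᵥ b ∷ᵥ h₁ ∷ᵥ h₂ ∷ᵥ h₃ ∷ᵥ []ᵥ))

  p≤q⇒0≤q-p : ∀ {p q} → p ≤ q → 0ℚ ≤ q - p
  p≤q⇒0≤q-p {p} {q} p≤q = subst (_≤ q - p) (ℚ.+-inverseʳ p) (ℚ.+-monoˡ-≤ (- p) p≤q)

  0≤q-p⇒p≤q : ∀ {p q} → 0ℚ ≤ q - p → p ≤ q
  0≤q-p⇒p≤q {p} {q} 0≤q-p = begin
    p             ≡⟨ ℚ.+-identityʳ p ⟨
    p + 0ℚ        ≤⟨ ℚ.+-monoʳ-≤ p 0≤q-p ⟩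
    p + (q - p)   ≡⟨ solve (p ∷ q ∷ []) ℚ-ring ⟩
    q             ∎
    where open ℚ.≤-Reasoning

  ≤-by-slack : ∀ {p q s} → 0ℚ ≤ s → q - p ≡ s → p ≤ q
  ≤-by-slack 0≤s q-p≡s = 0≤q-p⇒p≤q (subst (0ℚ ≤_) (sym q-p≡s) 0≤s)

  0≤-by : ∀ {p q} → 0ℚ ≤ p → p ≡ q → 0ℚ ≤ q
  0≤-by 0≤p p≡q = subst (0ℚ ≤_) p≡q 0≤p

  infixl 6 _+≥0_
  _+≥0_ : ∀ {p q} → 0ℚ ≤ p → 0ℚ ≤ q → 0ℚ ≤ p + q
  0≤p +≥0 0≤q = ℚ.+-mono-≤ 0≤p 0≤q

  infixl 7 _*≥0_
  _*≥0_ : ∀ {p q} → 0ℚ ≤ p → 0ℚ ≤ q → 0ℚ ≤ p * q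
  _*≥0_ {p} {q} 0≤p 0≤q =
    ℚ.nonNegative⁻¹ _ {{ℚ.nonNeg*nonNeg⇒nonNeg p {{nonNegative 0≤p}} q {{nonNegative 0≤q}}}}

  *-pos : ∀ {p q} → 0ℚ < p → 0ℚ < q → 0ℚ < p * q
  *-pos {p} {q} 0<p 0<q = ℚ.positive⁻¹ _ {{ℚ.pos*pos⇒pos p {{positive 0<p}} q {{positive 0<q}}}}

  0<⇒*-cancelˡ-≤ : ∀ {c p q} → 0ℚ < c → c * p ≤ c * q → p ≤ q
  0<⇒*-cancelˡ-≤ {c} 0<c = ℚ.*-cancelˡ-≤-pos c {{positive 0<c}}

  0<⇒*-cancelˡ-≡ : ∀ {c p q} → 0ℚ < c → c * p ≡ c * q → p ≡ q
  0<⇒*-cancelˡ-≡ 0<c cp≡cq =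
    ℚ.≤-antisym (0<⇒*-cancelˡ-≤ 0<c (ℚ.≤-reflexive cp≡cq)) (0<⇒*-cancelˡ-≤ 0<c (ℚ.≤-reflexive (sym cp≡cq)))

  ⊓-pres : ∀ (P : ℚ → Set) {p q} → P p → P q → P (p ⊓ q)
  ⊓-pres P {p} {q} Pp Pq = [ (λ eq → subst P (sym eq) Pp) , (λ eq → subst P (sym eq) Pq) ]′ (ℚ.⊓-sel p q)

  divide : (r c : ℚ) → 0ℚ < c → ℚ
  divide r c 0<c = (r ÷ c) {{ℚ.pos⇒nonZero c {{positive 0<c}}}}

  *-divide : ∀ r {c} (0<c : 0ℚ < c) → c * divide r c 0<c ≡ r
  *-divide r {c} 0<c = begin
    c * (r * 1/ c)    ≡⟨ ℚ.*-comm c (r * 1/ c) ⟩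
    r * 1/ c * c      ≡⟨ ℚ.*-assoc r (1/ c) c ⟩
    r * (1/ c * c)    ≡⟨ cong (r *_) (ℚ.*-inverseˡ c) ⟩
    r * 1ℚ            ≡⟨ ℚ.*-identityʳ r ⟩
    r                 ∎
    where
    open ≡-Reasoning
    instance
      c>0 : ℚ.Positive c
      c>0 = positive 0<c
      c≢0 : ℚ.NonZero c
      c≢0 = ℚ.pos⇒nonZero c

  divide-nonNeg : ∀ {r c} (0<c : 0ℚ < c) → 0ℚ ≤ r → 0ℚ ≤ divide r c 0<c
  divide-nonNeg {r} {c} 0<c 0≤r = 0≤r *≥0 ℚ.nonNegative⁻¹ (1/ c) {{ℚ.pos⇒nonNeg (1/ c) {{ℚ.1/pos⇒pos c}}}}
    where
    instance
      c>0 : ℚ.Positive c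
      c>0 = positive 0<c
      c≢0 : ℚ.NonZero c
      c≢0 = ℚ.pos⇒nonZero c

  -- The linear system of block totals

  -- The totals of an ROS over the index triples of each block type (X: 122, Y: 133, Z: 123,
  -- U: 222, V: 223, W: 233, T: 333), with the line sums over pairs of blocks as rows.
  record Totals (A B H₁ H₂ H₃ : ℚ) : Set where
    constructor totals
    field
      X Y Z U V W T : ℚ
      X≥0 : 0ℚ ≤ X
      Y≥0 : 0ℚ ≤ Y
      Z≥0 : 0ℚ ≤ Z
      V≥0 : 0ℚ ≤ V
      W≥0 : 0ℚ ≤ W
      U≥  : A * (H₂ * H₂) ≤ U
      T≥  : B * (H₃ * H₃) ≤ T
      row₁₂ : X + Z ≡ A * (H₁ * H₂)
      row₁₃ : Z + Y ≡ B * (H₁ * H₃)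
      row₂₂ : X + (U + V) ≡ A * (A * (H₂ * H₂))
      row₃₃ : Y + (W + T) ≡ B * (B * (H₃ * H₃))
      row₂₃ : Z + (V + W) ≡ A * (B * (H₂ * H₃))

  -- Totals in terms of Z and V: the rows of Totals give X, Y and W as below, and U - a·h₂² and
  -- T - b·h₃² as the last two expressions.
  record Feasible (A B H₁ H₂ H₃ Z V : ℚ) : Set where
    field
      Z≥0 : 0ℚ ≤ Z
      V≥0 : 0ℚ ≤ V
      X≥0 : 0ℚ ≤ A * H₁ * H₂ - Z
      Y≥0 : 0ℚ ≤ B * H₁ * H₃ - Z
      U≥0 : 0ℚ ≤ A * (A - 1ℚ) * H₂ * H₂ - (A * H₁ * H₂ - Z) - V
      W≥0 : 0ℚ ≤ A * B * H₂ * H₃ - Z - V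
      T≥0 : 0ℚ ≤ B * (B - 1ℚ) * H₃ * H₃ - (B * H₁ * H₃ - Z) - (A * B * H₂ * H₃ - Z - V)

  totals⇒feasible : ∀ {A B H₁ H₂ H₃} (t : Totals A B H₁ H₂ H₃) →
                    Feasible A B H₁ H₂ H₃ (Totals.Z t) (Totals.V t)
  totals⇒feasible {A} {B} {H₁} {H₂} {H₃}
    (totals X Y Z U V W T X≥0 Y≥0 Z≥0 V≥0 W≥0 U≥ T≥ row₁₂ row₁₃ row₂₂ row₃₃ row₂₃) = record
    { Z≥0 = Z≥0
    ; V≥0 = V≥0
    ; X≥0 = 0≤-by X≥0 (sym X≡)
    ; Y≥0 = 0≤-by Y≥0 (sym Y≡)
    ; U≥0 = 0≤-by (p≤q⇒0≤q-p U≥) (sym U-AH₂H₂≡)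
    ; W≥0 = 0≤-by W≥0 (sym W≡)
    ; T≥0 = 0≤-by (p≤q⇒0≤q-p T≥) (sym T-BH₃H₃≡)
    }
    where
    open ≡-Reasoning

    X≡ : A * H₁ * H₂ - Z ≡ X
    X≡ = begin
      A * H₁ * H₂ - Z     ≡⟨ solve (A ∷ H₁ ∷ H₂ ∷ Z ∷ []) ℚ-ring ⟩
      A * (H₁ * H₂) - Z   ≡⟨ cong (_- Z) row₁₂ ⟨
      X + Z - Z           ≡⟨ solve (X ∷ Z ∷ []) ℚ-ring ⟩
      X                   ∎

    Y≡ : B * H₁ * H₃ - Z ≡ Y
    Y≡ = begin
      B * H₁ * H₃ - Z     ≡⟨ solve (B ∷ H₁ ∷ H₃ ∷ Z ∷ []) ℚ-ring ⟩
      B * (H₁ * H₃) - Z   ≡⟨ cong (_- Z) row₁₃ ⟨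
      Z + Y - Z           ≡⟨ solve (Y ∷ Z ∷ []) ℚ-ring ⟩
      Y                   ∎

    W≡ : A * B * H₂ * H₃ - Z - V ≡ W
    W≡ = begin
      A * B * H₂ * H₃ - Z - V        ≡⟨ solve (A ∷ B ∷ H₂ ∷ H₃ ∷ Z ∷ V ∷ []) ℚ-ring ⟩
      A * (B * (H₂ * H₃)) - (Z + V)  ≡⟨ cong (_- (Z + V)) row₂₃ ⟨
      Z + (V + W) - (Z + V)          ≡⟨ solve (Z ∷ V ∷ W ∷ []) ℚ-ring ⟩
      W                              ∎

    U-AH₂H₂≡ : A * (A - 1ℚ) * H₂ * H₂ - (A * H₁ * H₂ - Z) - V ≡ U - A * (H₂ * H₂)
    U-AH₂H₂≡ = begin
      A * (A - 1ℚ) * H₂ * H₂ - (A * H₁ * H₂ - Z) - V  ≡⟨ cong (λ x → A * (A - 1ℚ) * H₂ * H₂ - x - V) X≡ ⟩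
      A * (A - 1ℚ) * H₂ * H₂ - X - V                  ≡⟨ solve (A ∷ H₂ ∷ X ∷ V ∷ []) ℚ-ring ⟩
      A * (A * (H₂ * H₂)) - (X + V) - A * (H₂ * H₂)   ≡⟨ cong (λ s → s - (X + V) - A * (H₂ * H₂)) row₂₂ ⟨
      X + (U + V) - (X + V) - A * (H₂ * H₂)           ≡⟨ solve (A ∷ H₂ ∷ X ∷ U ∷ V ∷ []) ℚ-ring ⟩
      U - A * (H₂ * H₂)                               ∎

    T-BH₃H₃≡ : B * (B - 1ℚ) * H₃ * H₃ - (B * H₁ * H₃ - Z) - (A * B * H₂ * H₃ - Z - V) ≡ T - B * (H₃ * H₃)
    T-BH₃H₃≡ = begin
      B * (B - 1ℚ) * H₃ * H₃ - (B * H₁ * H₃ - Z) - (A * B * H₂ * H₃ - Z - V)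
        ≡⟨ cong₂ (λ y w → B * (B - 1ℚ) * H₃ * H₃ - y - w) Y≡ W≡ ⟩
      B * (B - 1ℚ) * H₃ * H₃ - Y - W
        ≡⟨ solve (B ∷ H₃ ∷ Y ∷ W ∷ []) ℚ-ring ⟩
      B * (B * (H₃ * H₃)) - (Y + W) - B * (H₃ * H₃)
        ≡⟨ cong (λ s → s - (Y + W) - B * (H₃ * H₃)) row₃₃ ⟨
      Y + (W + T) - (Y + W) - B * (H₃ * H₃)
        ≡⟨ solve (B ∷ H₃ ∷ Y ∷ W ∷ T ∷ []) ℚ-ring ⟩
      T - B * (H₃ * H₃)
        ∎

  module _ {A B H₁ H₂ H₃ : ℚ} (0<A : 0ℚ < A) (0<B : 0ℚ < B) (0<H₂ : 0ℚ < H₂) (0<H₃ : 0ℚ < H₃) where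

    -- Every slack is a nonnegative combination of the totals; (1) and (2) arise multiplied by
    -- a·h₂ and b·h₃.
    feasible⇒conditions : ∀ {Z V} → Feasible A B H₁ H₂ H₃ Z V → Conditionsℚ A B H₁ H₂ H₃
    feasible⇒conditions {Z} {V} feasible = cond₁ , cond₂ , cond₃ , cond₄ , cond₅ , cond₆
      where
      open Feasible feasible

      cond₁ : H₁ ≤ (A - 1ℚ) * H₂ + B * H₃
      cond₁ = 0<⇒*-cancelˡ-≤ (*-pos 0<A 0<H₂) (≤-by-slack (U≥0 +≥0 V≥0 +≥0 V≥0 +≥0 W≥0)
        (solve (A ∷ B ∷ H₁ ∷ H₂ ∷ H₃ ∷ Z ∷ V ∷ []) ℚ-ring))

      cond₂ : H₁ ≤ (B - 1ℚ) * H₃ + A * H₂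
      cond₂ = 0<⇒*-cancelˡ-≤ (*-pos 0<B 0<H₃) (≤-by-slack (T≥0 +≥0 V≥0 +≥0 W≥0 +≥0 W≥0)
        (solve (A ∷ B ∷ H₁ ∷ H₂ ∷ H₃ ∷ Z ∷ V ∷ []) ℚ-ring))

      cond₃ : A * H₁ * H₂ - B * H₁ * H₃ ≤ A * (A - 1ℚ) * H₂ * H₂
      cond₃ = ≤-by-slack (U≥0 +≥0 V≥0 +≥0 Y≥0) (solve (A ∷ B ∷ H₁ ∷ H₂ ∷ H₃ ∷ Z ∷ V ∷ []) ℚ-ring)

      cond₄ : B * H₁ * H₃ - A * H₁ * H₂ ≤ B * (B - 1ℚ) * H₃ * H₃
      cond₄ = ≤-by-slack (T≥0 +≥0 W≥0 +≥0 X≥0) (solve (A ∷ B ∷ H₁ ∷ H₂ ∷ H₃ ∷ Z ∷ V ∷ []) ℚ-ring)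

      cond₅ : A * B * H₂ * H₃ - ℕ→ℚ 2 * A * H₁ * H₂ + B * H₁ * H₃
              ≤ A * (A - 1ℚ) * H₂ * H₂ + B * (B - 1ℚ) * H₃ * H₃
      cond₅ = ≤-by-slack (U≥0 +≥0 T≥0 +≥0 X≥0 +≥0 X≥0 +≥0 X≥0)
        (solve (A ∷ B ∷ H₁ ∷ H₂ ∷ H₃ ∷ Z ∷ V ∷ []) ℚ-ring)

      cond₆ : A * B * H₂ * H₃ - ℕ→ℚ 2 * B * H₁ * H₃ + A * H₁ * H₂
              ≤ A * (A - 1ℚ) * H₂ * H₂ + B * (B - 1ℚ) * H₃ * H₃
      cond₆ = ≤-by-slack (U≥0 +≥0 T≥0 +≥0 Y≥0 +≥0 Y≥0 +≥0 Y≥0)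
        (solve (A ∷ B ∷ H₁ ∷ H₂ ∷ H₃ ∷ Z ∷ V ∷ []) ℚ-ring)

  module _ {A B H₁ H₂ H₃ : ℚ}
           (0≤A : 0ℚ ≤ A) (0≤B : 0ℚ ≤ B) (0≤A-1 : 0ℚ ≤ A - 1ℚ) (0≤B-1 : 0ℚ ≤ B - 1ℚ)
           (0≤H₁ : 0ℚ ≤ H₁) (0≤H₂ : 0ℚ ≤ H₂) (0≤H₃ : 0ℚ ≤ H₃) where

    -- With P = a(a-1)h₂² - X, Q = b(b-1)h₃² - Y and R = ab h₂h₃ - Z, Feasible Z V asks for
    -- V ≤ P, V ≤ R and R - V ≤ Q, so V = P ⊓ R works iff P, Q and P + Q - R are nonnegative.
    Admissible : ℚ → Set
    Admissible Z =
        (0ℚ ≤ A * (A - 1ℚ) * H₂ * H₂ - (A * H₁ * H₂ - Z))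
      × (0ℚ ≤ B * (B - 1ℚ) * H₃ * H₃ - (B * H₁ * H₃ - Z))
      × (0ℚ ≤ A * (A - 1ℚ) * H₂ * H₂ - (A * H₁ * H₂ - Z) + (B * (B - 1ℚ) * H₃ * H₃ - (B * H₁ * H₃ - Z))
                - (A * B * H₂ * H₃ - Z))

    admissible⇒feasible : ∀ {Z} → 0ℚ ≤ Z → Z ≤ A * H₁ * H₂ → Z ≤ B * H₁ * H₃ → Z ≤ A * B * H₂ * H₃ →
      Admissible Z →
      Feasible A B H₁ H₂ H₃ Z ((A * (A - 1ℚ) * H₂ * H₂ - (A * H₁ * H₂ - Z)) ⊓ (A * B * H₂ * H₃ - Z))
    admissible⇒feasible {Z} 0≤Z Z≤AH₁H₂ Z≤BH₁H₃ Z≤ABH₂H₃ (0≤P , 0≤Q , 0≤P+Q-R) =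
      -- let rather than where: the ring solver must see P and R unfolded.
      let P = A * (A - 1ℚ) * H₂ * H₂ - (A * H₁ * H₂ - Z)
          R = A * B * H₂ * H₃ - Z
      in record
      { Z≥0 = 0≤Z
      ; V≥0 = ⊓-pres (0ℚ ≤_) 0≤P (p≤q⇒0≤q-p Z≤ABH₂H₃)
      ; X≥0 = p≤q⇒0≤q-p Z≤AH₁H₂
      ; Y≥0 = p≤q⇒0≤q-p Z≤BH₁H₃
      ; U≥0 = p≤q⇒0≤q-p (ℚ.p⊓q≤p P R)
      ; W≥0 = p≤q⇒0≤q-p (ℚ.p⊓q≤q P R)
      ; T≥0 = ⊓-pres (λ V → 0ℚ ≤ B * (B - 1ℚ) * H₃ * H₃ - (B * H₁ * H₃ - Z) - (R - V)) {P} {R}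
                (0≤-by 0≤P+Q-R (solve (A ∷ B ∷ H₁ ∷ H₂ ∷ H₃ ∷ Z ∷ []) ℚ-ring))
                (0≤-by 0≤Q (solve (A ∷ B ∷ H₁ ∷ H₂ ∷ H₃ ∷ Z ∷ []) ℚ-ring))
      }

    admissible-AH₁H₂ : B * H₁ * H₃ - A * H₁ * H₂ ≤ B * (B - 1ℚ) * H₃ * H₃ →
      A * B * H₂ * H₃ - ℕ→ℚ 2 * A * H₁ * H₂ + B * H₁ * H₃ ≤ A * (A - 1ℚ) * H₂ * H₂ + B * (B - 1ℚ) * H₃ * H₃ →
      Admissible (A * H₁ * H₂)
    admissible-AH₁H₂ cond₄ cond₅ =
        0≤-by (0≤A *≥0 0≤A-1 *≥0 0≤H₂ *≥0 0≤H₂) (solve (A ∷ H₁ ∷ H₂ ∷ []) ℚ-ring)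
      , p≤q⇒0≤q-p cond₄
      , 0≤-by (p≤q⇒0≤q-p cond₅) (solve (A ∷ B ∷ H₁ ∷ H₂ ∷ H₃ ∷ []) ℚ-ring)

    admissible-BH₁H₃ : A * H₁ * H₂ - B * H₁ * H₃ ≤ A * (A - 1ℚ) * H₂ * H₂ →
      A * B * H₂ * H₃ - ℕ→ℚ 2 * B * H₁ * H₃ + A * H₁ * H₂ ≤ A * (A - 1ℚ) * H₂ * H₂ + B * (B - 1ℚ) * H₃ * H₃ →
      Admissible (B * H₁ * H₃)
    admissible-BH₁H₃ cond₃ cond₆ =
        p≤q⇒0≤q-p cond₃
      , 0≤-by (0≤B *≥0 0≤B-1 *≥0 0≤H₃ *≥0 0≤H₃) (solve (B ∷ H₁ ∷ H₃ ∷ []) ℚ-ring)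
      , 0≤-by (p≤q⇒0≤q-p cond₆) (solve (A ∷ B ∷ H₁ ∷ H₂ ∷ H₃ ∷ []) ℚ-ring)

    admissible-ABH₂H₃ : H₁ ≤ (A - 1ℚ) * H₂ + B * H₃ → H₁ ≤ (B - 1ℚ) * H₃ + A * H₂ →
      Admissible (A * B * H₂ * H₃)
    admissible-ABH₂H₃ cond₁ cond₂ =
        0≤-by (0≤AH₂ *≥0 p≤q⇒0≤q-p cond₁) (solve (A ∷ B ∷ H₁ ∷ H₂ ∷ H₃ ∷ []) ℚ-ring)
      , 0≤-by (0≤BH₃ *≥0 p≤q⇒0≤q-p cond₂) (solve (A ∷ B ∷ H₁ ∷ H₂ ∷ H₃ ∷ []) ℚ-ring)
      , 0≤-by (0≤AH₂ *≥0 p≤q⇒0≤q-p cond₁ +≥0 0≤BH₃ *≥0 p≤q⇒0≤q-p cond₂)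
              (solve (A ∷ B ∷ H₁ ∷ H₂ ∷ H₃ ∷ []) ℚ-ring)
      where
      0≤AH₂ = 0≤A *≥0 0≤H₂
      0≤BH₃ = 0≤B *≥0 0≤H₃

    -- Z is the largest value keeping X, Y and W nonnegative; at each of the three candidates
    -- Admissible amounts to two of the six conditions.
    conditions⇒feasible : Conditionsℚ A B H₁ H₂ H₃ → ∃₂ (Feasible A B H₁ H₂ H₃)
    conditions⇒feasible (cond₁ , cond₂ , cond₃ , cond₄ , cond₅ , cond₆) = _ , _ ,
      admissible⇒feasible
        (⊓-pres (0ℚ ≤_) (⊓-pres (0ℚ ≤_) 0≤AH₁H₂ 0≤BH₁H₃) 0≤ABH₂H₃)
        (ℚ.≤-trans (ℚ.p⊓q≤p (AH₁H₂ ⊓ BH₁H₃) ABH₂H₃) (ℚ.p⊓q≤p AH₁H₂ BH₁H₃))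
        (ℚ.≤-trans (ℚ.p⊓q≤p (AH₁H₂ ⊓ BH₁H₃) ABH₂H₃) (ℚ.p⊓q≤q AH₁H₂ BH₁H₃))
        (ℚ.p⊓q≤q (AH₁H₂ ⊓ BH₁H₃) ABH₂H₃)
        (⊓-pres Admissible
          (⊓-pres Admissible (admissible-AH₁H₂ cond₄ cond₅) (admissible-BH₁H₃ cond₃ cond₆))
          (admissible-ABH₂H₃ cond₁ cond₂))
      where
      AH₁H₂ = A * H₁ * H₂
      BH₁H₃ = B * H₁ * H₃
      ABH₂H₃ = A * B * H₂ * H₃
      0≤AH₁H₂ = 0≤A *≥0 0≤H₁ *≥0 0≤H₂
      0≤BH₁H₃ = 0≤B *≥0 0≤H₁ *≥0 0≤H₃
      0≤ABH₂H₃ = 0≤A *≥0 0≤B *≥0 0≤H₂ *≥0 0≤H₃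

  -- Averaging totals into values

  -- The values of an ROS that is constant on each block type, at pairwise distinct index triples of
  -- types 122 (x), 133 (y), 123 (z), 222 (u), 223 (v), 233 (w), 333 (t); the rows are its line sums.
  record BlockValues (A B H₁ H₂ H₃ : ℚ) : Set where
    field
      x y z u v w t : ℚ
      x≥0 : 0ℚ ≤ x
      y≥0 : 0ℚ ≤ y
      z≥0 : 0ℚ ≤ z
      u≥0 : 0ℚ ≤ u
      v≥0 : 0ℚ ≤ v
      w≥0 : 0ℚ ≤ w
      t≥0 : 0ℚ ≤ t
      row₁₂ : (A - 1ℚ) * x + B * z ≡ H₁ * H₂
      row₁₃ : A * z + (B - 1ℚ) * y ≡ H₁ * H₃
      row₂₂ : x + (A - ℕ→ℚ 2) * u + B * v ≡ H₂ * H₂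
      row₃₃ : y + A * w + (B - ℕ→ℚ 2) * t ≡ H₃ * H₃
      row₂₃ : z + (A - 1ℚ) * v + (B - 1ℚ) * w ≡ H₂ * H₃

  module _ {A B H₁ H₂ H₃ : ℚ}
           (0<A : 0ℚ < A) (0<B : 0ℚ < B) (0<A-1 : 0ℚ < A - 1ℚ) (0<B-1 : 0ℚ < B - 1ℚ)
           (0<A-2 : 0ℚ < A - ℕ→ℚ 2) (0<B-2 : 0ℚ < B - ℕ→ℚ 2) where

    private
      open ≡-Reasoning

      row₁₂-by-averaging : ∀ {Z x z} → A * (A - 1ℚ) * x ≡ A * H₁ * H₂ - Z → A * B * z ≡ Z →
                           (A - 1ℚ) * x + B * z ≡ H₁ * H₂
      row₁₂-by-averaging {Z} {x} {z} Ax Az = 0<⇒*-cancelˡ-≡ 0<A (begin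
        A * ((A - 1ℚ) * x + B * z)     ≡⟨ solve (A ∷ B ∷ x ∷ z ∷ []) ℚ-ring ⟩
        A * (A - 1ℚ) * x + A * B * z   ≡⟨ cong₂ _+_ Ax Az ⟩
        A * H₁ * H₂ - Z + Z            ≡⟨ solve (A ∷ H₁ ∷ H₂ ∷ Z ∷ []) ℚ-ring ⟩
        A * (H₁ * H₂)                  ∎)

      row₁₃-by-averaging : ∀ {Z y z} → B * (B - 1ℚ) * y ≡ B * H₁ * H₃ - Z → A * B * z ≡ Z →
                           A * z + (B - 1ℚ) * y ≡ H₁ * H₃
      row₁₃-by-averaging {Z} {y} {z} By Bz = 0<⇒*-cancelˡ-≡ 0<B (begin
        B * (A * z + (B - 1ℚ) * y)     ≡⟨ solve (A ∷ B ∷ y ∷ z ∷ []) ℚ-ring ⟩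
        B * (B - 1ℚ) * y + A * B * z   ≡⟨ cong₂ _+_ By Bz ⟩
        B * H₁ * H₃ - Z + Z            ≡⟨ solve (B ∷ H₁ ∷ H₃ ∷ Z ∷ []) ℚ-ring ⟩
        B * (H₁ * H₃)                  ∎)

      row₂₂-by-averaging : ∀ {Z V x u v} → A * (A - 1ℚ) * x ≡ A * H₁ * H₂ - Z →
        A * (A - 1ℚ) * (A - ℕ→ℚ 2) * u ≡ A * (A - 1ℚ) * H₂ * H₂ - (A * H₁ * H₂ - Z) - V →
        A * (A - 1ℚ) * B * v ≡ V →
        x + (A - ℕ→ℚ 2) * u + B * v ≡ H₂ * H₂
      row₂₂-by-averaging {Z} {V} {x} {u} {v} Ax Au Av = 0<⇒*-cancelˡ-≡ (*-pos 0<A 0<A-1) (begin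
        A * (A - 1ℚ) * (x + (A - ℕ→ℚ 2) * u + B * v)
          ≡⟨ solve (A ∷ B ∷ x ∷ u ∷ v ∷ []) ℚ-ring ⟩
        A * (A - 1ℚ) * x + A * (A - 1ℚ) * (A - ℕ→ℚ 2) * u + A * (A - 1ℚ) * B * v
          ≡⟨ cong₂ _+_ (cong₂ _+_ Ax Au) Av ⟩
        A * H₁ * H₂ - Z + (A * (A - 1ℚ) * H₂ * H₂ - (A * H₁ * H₂ - Z) - V) + V
          ≡⟨ solve (A ∷ H₁ ∷ H₂ ∷ Z ∷ V ∷ []) ℚ-ring ⟩
        A * (A - 1ℚ) * (H₂ * H₂)
          ∎)

      row₃₃-by-averaging : ∀ {Z V y w t} → B * (B - 1ℚ) * y ≡ B * H₁ * H₃ - Z →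
        A * B * (B - 1ℚ) * w ≡ A * B * H₂ * H₃ - Z - V →
        B * (B - 1ℚ) * (B - ℕ→ℚ 2) * t ≡ B * (B - 1ℚ) * H₃ * H₃ - (B * H₁ * H₃ - Z) - (A * B * H₂ * H₃ - Z - V) →
        y + A * w + (B - ℕ→ℚ 2) * t ≡ H₃ * H₃
      row₃₃-by-averaging {Z} {V} {y} {w} {t} By Bw Bt = 0<⇒*-cancelˡ-≡ (*-pos 0<B 0<B-1) (begin
        B * (B - 1ℚ) * (y + A * w + (B - ℕ→ℚ 2) * t)
          ≡⟨ solve (A ∷ B ∷ y ∷ w ∷ t ∷ []) ℚ-ring ⟩
        B * (B - 1ℚ) * y + A * B * (B - 1ℚ) * w + B * (B - 1ℚ) * (B - ℕ→ℚ 2) * t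
          ≡⟨ cong₂ _+_ (cong₂ _+_ By Bw) Bt ⟩
        B * H₁ * H₃ - Z + (A * B * H₂ * H₃ - Z - V)
          + (B * (B - 1ℚ) * H₃ * H₃ - (B * H₁ * H₃ - Z) - (A * B * H₂ * H₃ - Z - V))
          ≡⟨ solve (A ∷ B ∷ H₁ ∷ H₂ ∷ H₃ ∷ Z ∷ V ∷ []) ℚ-ring ⟩
        B * (B - 1ℚ) * (H₃ * H₃)
          ∎)

      row₂₃-by-averaging : ∀ {Z V z v w} → A * B * z ≡ Z → A * (A - 1ℚ) * B * v ≡ V →
        A * B * (B - 1ℚ) * w ≡ A * B * H₂ * H₃ - Z - V →
        z + (A - 1ℚ) * v + (B - 1ℚ) * w ≡ H₂ * H₃
      row₂₃-by-averaging {Z} {V} {z} {v} {w} Az Av Aw = 0<⇒*-cancelˡ-≡ (*-pos 0<A 0<B) (begin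
        A * B * (z + (A - 1ℚ) * v + (B - 1ℚ) * w)
          ≡⟨ solve (A ∷ B ∷ z ∷ v ∷ w ∷ []) ℚ-ring ⟩
        A * B * z + A * (A - 1ℚ) * B * v + A * B * (B - 1ℚ) * w
          ≡⟨ cong₂ _+_ (cong₂ _+_ Az Av) Aw ⟩
        Z + V + (A * B * H₂ * H₃ - Z - V)
          ≡⟨ solve (A ∷ B ∷ H₂ ∷ H₃ ∷ Z ∷ V ∷ []) ℚ-ring ⟩
        A * B * (H₂ * H₃)
          ∎)

    -- Each total is spread evenly over the ordered triples of its type, e.g. a(a-1) triples for 122.
    feasible⇒blockValues : ∀ {Z V} → Feasible A B H₁ H₂ H₃ Z V → BlockValues A B H₁ H₂ H₃
    feasible⇒blockValues {Z} {V} feasible = record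
      { x = divide (A * H₁ * H₂ - Z) _ 0<cx
      ; y = divide (B * H₁ * H₃ - Z) _ 0<cy
      ; z = divide Z _ 0<cz
      ; u = divide (A * (A - 1ℚ) * H₂ * H₂ - (A * H₁ * H₂ - Z) - V) _ 0<cu
      ; v = divide V _ 0<cv
      ; w = divide (A * B * H₂ * H₃ - Z - V) _ 0<cw
      ; t = divide (B * (B - 1ℚ) * H₃ * H₃ - (B * H₁ * H₃ - Z) - (A * B * H₂ * H₃ - Z - V)) _ 0<ct
      ; x≥0 = divide-nonNeg 0<cx X≥0
      ; y≥0 = divide-nonNeg 0<cy Y≥0
      ; z≥0 = divide-nonNeg 0<cz Z≥0
      ; u≥0 = divide-nonNeg 0<cu U≥0
      ; v≥0 = divide-nonNeg 0<cv V≥0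
      ; w≥0 = divide-nonNeg 0<cw W≥0
      ; t≥0 = divide-nonNeg 0<ct T≥0
      ; row₁₂ = row₁₂-by-averaging (*-divide _ 0<cx) (*-divide Z 0<cz)
      ; row₁₃ = row₁₃-by-averaging (*-divide _ 0<cy) (*-divide Z 0<cz)
      ; row₂₂ = row₂₂-by-averaging (*-divide _ 0<cx) (*-divide _ 0<cu) (*-divide V 0<cv)
      ; row₃₃ = row₃₃-by-averaging (*-divide _ 0<cy) (*-divide _ 0<cw) (*-divide _ 0<ct)
      ; row₂₃ = row₂₃-by-averaging (*-divide Z 0<cz) (*-divide V 0<cv) (*-divide _ 0<cw)
      }
      where
      open Feasible feasible
      0<cx : 0ℚ < A * (A - 1ℚ)
      0<cx = *-pos 0<A 0<A-1
      0<cy : 0ℚ < B * (B - 1ℚ)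
      0<cy = *-pos 0<B 0<B-1
      0<cz : 0ℚ < A * B
      0<cz = *-pos 0<A 0<B
      0<cu : 0ℚ < A * (A - 1ℚ) * (A - ℕ→ℚ 2)
      0<cu = *-pos 0<cx 0<A-2
      0<cv : 0ℚ < A * (A - 1ℚ) * B
      0<cv = *-pos 0<cx 0<B
      0<cw : 0ℚ < A * B * (B - 1ℚ)
      0<cw = *-pos 0<cz 0<B-1
      0<ct : 0ℚ < B * (B - 1ℚ) * (B - ℕ→ℚ 2)
      0<ct = *-pos 0<cy 0<B-2

  Σℚ-cong : ∀ {k} {f g : Fin k → ℚ} → (∀ i → f i ≡ g i) → Σℚ f ≡ Σℚ g
  Σℚ-cong {ℕ.zero}  f≗g = refl
  Σℚ-cong {ℕ.suc k} f≗g = cong₂ _+_ (f≗g zero) (Σℚ-cong (λ i → f≗g (suc i)))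

  Σℚ-distrib-+ : ∀ {k} (f g : Fin k → ℚ) → Σℚ (λ i → f i + g i) ≡ Σℚ f + Σℚ g
  Σℚ-distrib-+ {ℕ.zero}  f g = refl
  Σℚ-distrib-+ {ℕ.suc k} f g =
    trans (cong ((f zero + g zero) +_) (Σℚ-distrib-+ (f ∘ suc) (g ∘ suc))) (swap (f zero) (g zero) _ _)
    where
    swap : ∀ p q r s → p + q + (r + s) ≡ p + r + (q + s)
    swap p q r s = solve (p ∷ q ∷ r ∷ s ∷ []) ℚ-ring

  Σℚ-const : ∀ k c → Σℚ {k} (λ _ → c) ≡ ℕ→ℚ k * c
  Σℚ-const ℕ.zero    c = sym (ℚ.*-zeroˡ c)
  Σℚ-const (ℕ.suc k) c = begin
    c + Σℚ {k} (λ _ → c)    ≡⟨ cong (c +_) (Σℚ-const k c) ⟩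
    c + ℕ→ℚ k * c           ≡⟨ cong (_+ ℕ→ℚ k * c) (ℚ.*-identityˡ c) ⟨
    1ℚ * c + ℕ→ℚ k * c      ≡⟨ ℚ.*-distribʳ-+ c 1ℚ (ℕ→ℚ k) ⟨
    (1ℚ + ℕ→ℚ k) * c        ≡⟨ cong (_* c) (ℤ→ℚ-homo-+ (ℤ.+ 1) (ℤ.+ k)) ⟨
    ℕ→ℚ (ℕ.suc k) * c       ∎
    where open ≡-Reasoning

  Σℚ-zero : ∀ {k} (f : Fin k → ℚ) → (∀ i → f i ≡ 0ℚ) → Σℚ f ≡ 0ℚ
  Σℚ-zero {ℕ.zero}  f f≗0 = refl
  Σℚ-zero {ℕ.suc k} f f≗0 = cong₂ _+_ (f≗0 zero) (Σℚ-zero _ (λ i → f≗0 (suc i)))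

  Σℚ-single : ∀ {k} (f : Fin k → ℚ) i → (∀ l → l ≢ i → f l ≡ 0ℚ) → Σℚ f ≡ f i
  Σℚ-single {ℕ.suc k} f zero    f≗0 =
    trans (cong (f zero +_) (Σℚ-zero _ (λ l → f≗0 (suc l) (λ ())))) (ℚ.+-identityʳ _)
  Σℚ-single {ℕ.suc k} f (suc i) f≗0 =
    trans (cong₂ _+_ (f≗0 zero (λ ())) (Σℚ-single (f ∘ suc) i (λ l l≢i → f≗0 (suc l) (l≢i ∘ suc-injective))))
          (ℚ.+-identityˡ _)

  Σℚ-pair : ∀ {k} (f : Fin k → ℚ) {i j} → i ≢ j → (∀ l → l ≢ i → l ≢ j → f l ≡ 0ℚ) → Σℚ f ≡ f i + f j
  Σℚ-pair {ℕ.suc k} f {zero}  {zero}  i≢j f≗0 = ⊥-elim (i≢j refl)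
  Σℚ-pair {ℕ.suc k} f {zero}  {suc j} i≢j f≗0 =
    cong (f zero +_) (Σℚ-single (f ∘ suc) j (λ l l≢j → f≗0 (suc l) (λ ()) (l≢j ∘ suc-injective)))
  Σℚ-pair {ℕ.suc k} f {suc i} {zero}  i≢j f≗0 =
    trans (cong (f zero +_) (Σℚ-single (f ∘ suc) i (λ l l≢i → f≗0 (suc l) (l≢i ∘ suc-injective) (λ ()))))
          (ℚ.+-comm (f zero) (f (suc i)))
  Σℚ-pair {ℕ.suc k} f {suc i} {suc j} i≢j f≗0 =
    trans (cong₂ _+_ (f≗0 zero (λ ()) (λ ()))
                     (Σℚ-pair (f ∘ suc) (i≢j ∘ cong suc)
                        (λ l l≢i l≢j → f≗0 (suc l) (l≢i ∘ suc-injective) (l≢j ∘ suc-injective))))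
          (ℚ.+-identityˡ _)

  Σℚ-++ : ∀ m {n} (f : Fin (m ℕ.+ n) → ℚ) → Σℚ f ≡ Σℚ (λ i → f (i ↑ˡ n)) + Σℚ (λ i → f (m ↑ʳ i))
  Σℚ-++ ℕ.zero    f = sym (ℚ.+-identityˡ _)
  Σℚ-++ (ℕ.suc m) f = trans (cong (f zero +_) (Σℚ-++ m (f ∘ suc))) (sym (ℚ.+-assoc (f zero) _ _))

  Σℚ-swap : ∀ {m n} (f : Fin m → Fin n → ℚ) → Σℚ (λ i → Σℚ (f i)) ≡ Σℚ (λ j → Σℚ (λ i → f i j))
  Σℚ-swap {ℕ.zero}  {n} f = sym (Σℚ-zero {n} _ (λ _ → refl))
  Σℚ-swap {ℕ.suc m} {n} f = trans (cong (Σℚ (f zero) +_) (Σℚ-swap (f ∘ suc)))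
                                  (sym (Σℚ-distrib-+ (f zero) (λ j → Σℚ (λ i → f (suc i) j))))

  Σℚ-nonNeg : ∀ {k} {f : Fin k → ℚ} → (∀ i → 0ℚ ≤ f i) → 0ℚ ≤ Σℚ f
  Σℚ-nonNeg {ℕ.zero}  f≥0 = ℚ.≤-refl
  Σℚ-nonNeg {ℕ.suc k} f≥0 = f≥0 zero +≥0 Σℚ-nonNeg (f≥0 ∘ suc)

  Σℚ-mono-≤ : ∀ {k} {f g : Fin k → ℚ} → (∀ i → f i ≤ g i) → Σℚ f ≤ Σℚ g
  Σℚ-mono-≤ {ℕ.zero}  f≤g = ℚ.≤-refl
  Σℚ-mono-≤ {ℕ.suc k} f≤g = ℚ.+-mono-≤ (f≤g zero) (Σℚ-mono-≤ (f≤g ∘ suc))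

  term≤Σℚ : ∀ {k} {f : Fin k → ℚ} → (∀ i → 0ℚ ≤ f i) → ∀ i → f i ≤ Σℚ f
  term≤Σℚ {ℕ.suc k} {f} f≥0 zero    =
    subst (_≤ Σℚ f) (ℚ.+-identityʳ (f zero)) (ℚ.+-monoʳ-≤ (f zero) (Σℚ-nonNeg (f≥0 ∘ suc)))
  term≤Σℚ {ℕ.suc k} {f} f≥0 (suc i) =
    subst (_≤ Σℚ f) (ℚ.+-identityˡ (f (suc i))) (ℚ.+-mono-≤ (f≥0 zero) (term≤Σℚ (f≥0 ∘ suc) i))

  Σℚ-distrib-+₃ : ∀ {k} (f g h : Fin k → ℚ) → Σℚ (λ i → f i + (g i + h i)) ≡ Σℚ f + (Σℚ g + Σℚ h)
  Σℚ-distrib-+₃ f g h = trans (Σℚ-distrib-+ f _) (cong (Σℚ f +_) (Σℚ-distrib-+ g h))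

  Σℚ-off-pair : ∀ {k} {f g : Fin k → ℚ} {i j} → i ≢ j → f i ≡ 0ℚ → f j ≡ 0ℚ →
                (∀ l → l ≢ i → l ≢ j → f l ≡ g l) → Σℚ f ≡ Σℚ g - (g i + g j)
  Σℚ-off-pair {f = f} {g} {i} {j} i≢j fi≡0 fj≡0 f≗g = begin
    Σℚ f                                ≡⟨ add-sub (Σℚ f) (Σℚ d) ⟩
    Σℚ f + Σℚ d - Σℚ d                  ≡⟨ cong (_- Σℚ d) (Σℚ-distrib-+ f d) ⟨
    Σℚ (λ l → f l + d l) - Σℚ d         ≡⟨ cong₂ _-_ (Σℚ-cong λ l → sub-add (g l) (f l)) (Σℚ-pair d i≢j d≗0) ⟩
    Σℚ g - (d i + d j)                  ≡⟨ cong₂ (λ p q → Σℚ g - (g i - p + (g j - q))) fi≡0 fj≡0 ⟩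
    Σℚ g - (g i - 0ℚ + (g j - 0ℚ))      ≡⟨ cong₂ (λ p q → Σℚ g - (p + q)) (ℚ.+-identityʳ (g i)) (ℚ.+-identityʳ (g j)) ⟩
    Σℚ g - (g i + g j)                  ∎
    where
    open ≡-Reasoning
    d : _ → ℚ
    d l = g l - f l
    d≗0 : ∀ l → l ≢ i → l ≢ j → d l ≡ 0ℚ
    d≗0 l l≢i l≢j = trans (cong (λ q → g l - q) (f≗g l l≢i l≢j)) (ℚ.+-inverseʳ (g l))
    add-sub : ∀ p q → p ≡ p + q - q
    add-sub p q = solve (p ∷ q ∷ []) ℚ-ring
    sub-add : ∀ p q → q + (p - q) ≡ p
    sub-add p q = solve (p ∷ q ∷ []) ℚ-ring

  data Block : Set where
    blk₁ blk₂ blk₃ : Block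

  onBlock : ∀ {A : Set} → A → A → A → Block → A
  onBlock x₁ x₂ x₃ blk₁ = x₁
  onBlock x₁ x₂ x₃ blk₂ = x₂
  onBlock x₁ x₂ x₃ blk₃ = x₃

  onBlock-map : ∀ {A B : Set} (f : A → B) {x₁ x₂ x₃} c → f (onBlock x₁ x₂ x₃ c) ≡ onBlock (f x₁) (f x₂) (f x₃) c
  onBlock-map f blk₁ = refl
  onBlock-map f blk₂ = refl
  onBlock-map f blk₃ = refl

  module Blocks (a b : ℕ) where

    size : Block → ℕ
    size = onBlock 1 a b

    member : (c : Block) → Fin (size c) → Fin (ℕ.suc (a ℕ.+ b))
    member blk₁ _ = zero
    member blk₂ j = suc (j ↑ˡ b)
    member blk₃ l = suc (a ↑ʳ l)

    block : Fin (ℕ.suc (a ℕ.+ b)) → Block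
    block zero    = blk₁
    block (suc i) = [ const blk₂ , const blk₃ ]′ (splitAt a i)

    block-member : ∀ c k → block (member c k) ≡ c
    block-member blk₁ k = refl
    block-member blk₂ j rewrite splitAt-↑ˡ a j b = refl
    block-member blk₃ l rewrite splitAt-↑ʳ a b l = refl

    seq3-block : ∀ h₁ h₂ h₃ i → seq3 h₁ h₂ h₃ a b i ≡ onBlock h₁ h₂ h₃ (block i)
    seq3-block h₁ h₂ h₃ zero = refl
    seq3-block h₁ h₂ h₃ (suc k) with splitAt a k in eq
    ... | inj₁ j = cong (if_then h₂ else h₃) (dec-true (toℕ k ℕ.<? a) k<a)
      where
      k<a : toℕ k ℕ.< a
      k<a = subst (λ i → toℕ i ℕ.< a) (splitAt⁻¹-↑ˡ eq) (subst (ℕ._< a) (sym (toℕ-↑ˡ j b)) (toℕ<n j))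
    ... | inj₂ l = cong (if_then h₂ else h₃) (dec-false (toℕ k ℕ.<? a) k≮a)
      where
      k≮a : ¬ toℕ k ℕ.< a
      k≮a = subst (λ i → ¬ toℕ i ℕ.< a) (splitAt⁻¹-↑ʳ eq)
              (subst (λ n → ¬ n ℕ.< a) (sym (toℕ-↑ʳ a l)) (ℕ.m+n≮m a (toℕ l)))

    block≡blk₁⇒zero : ∀ i → block i ≡ blk₁ → i ≡ zero
    block≡blk₁⇒zero zero    _  = refl
    block≡blk₁⇒zero (suc k) eq = ⊥-elim (suc≢blk₁ (splitAt a k) eq)
      where
      suc≢blk₁ : ∀ s → [ const blk₂ , const blk₃ ]′ s ≢ blk₁
      suc≢blk₁ (inj₁ _) ()
      suc≢blk₁ (inj₂ _) ()

    seq3-member : ∀ h₁ h₂ h₃ c k → seq3 h₁ h₂ h₃ a b (member c k) ≡ onBlock h₁ h₂ h₃ c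
    seq3-member h₁ h₂ h₃ c k =
      trans (seq3-block h₁ h₂ h₃ (member c k)) (cong (onBlock h₁ h₂ h₃) (block-member c k))

    ∑ : Block → (Fin (ℕ.suc (a ℕ.+ b)) → ℚ) → ℚ
    ∑ c f = Σℚ (λ k → f (member c k))

    syntax ∑ c (λ i → e) = ∑[ i ∈ c ] e

    Σℚ-blocks : ∀ f → Σℚ f ≡ ∑ blk₁ f + (∑ blk₂ f + ∑ blk₃ f)
    Σℚ-blocks f = cong₂ _+_ (sym (ℚ.+-identityʳ (f zero))) (Σℚ-++ a (f ∘ suc))

    Σℚ-by-block : ∀ (G : Block → ℚ) → Σℚ (G ∘ block) ≡ G blk₁ + (ℕ→ℚ a * G blk₂ + ℕ→ℚ b * G blk₃)
    Σℚ-by-block G = trans (Σℚ-blocks (G ∘ block))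
      (cong₂ _+_ (ℚ.+-identityʳ (G blk₁)) (cong₂ _+_ (constant blk₂) (constant blk₃)))
      where
      constant : ∀ c → ∑ c (G ∘ block) ≡ ℕ→ℚ (size c) * G c
      constant c = trans (Σℚ-cong (λ k → cong G (block-member c k))) (Σℚ-const (size c) (G c))

  -- From an ROS to its block totals

  module Aggregation {a b h₁ h₂ h₃ : ℕ} (R : ROS (ℕ.suc (a ℕ.+ b)) (seq3 h₁ h₂ h₃ a b)) where
    open ROS R
    open Blocks a b

    H : Block → ℚ
    H c = ℕ→ℚ (onBlock h₁ h₂ h₃ c)

    total : Block → Block → Block → ℚ
    total c d e = ∑[ i ∈ c ] ∑[ j ∈ d ] ∑[ l ∈ e ] O i j l

    total-swap₁₂ : ∀ c d e → total c d e ≡ total d c e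
    total-swap₁₂ c d e = trans (Σℚ-swap λ i j → ∑[ l ∈ e ] O (member c i) (member d j) l)
      (Σℚ-cong λ j → Σℚ-cong λ i → Σℚ-cong λ l → sym₁₂ (member c i) (member d j) (member e l))

    total-swap₂₃ : ∀ c d e → total c d e ≡ total c e d
    total-swap₂₃ c d e = Σℚ-cong λ i → trans (Σℚ-swap λ j l → O (member c i) (member d j) (member e l))
      (Σℚ-cong λ l → Σℚ-cong λ j → sym₂₃ (member c i) (member d j) (member e l))

    total-rotate : ∀ c d e → total c d e ≡ total e c d
    total-rotate c d e = trans (total-swap₂₃ c d e) (total-swap₁₂ c e d)

    total-nonNeg : ∀ c d e → 0ℚ ≤ total c d e
    total-nonNeg c d e =
      Σℚ-nonNeg λ i → Σℚ-nonNeg λ j → Σℚ-nonNeg λ l → nonneg (member c i) (member d j) (member e l)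

    total₁₁ : ∀ c → c ≢ blk₁ → total blk₁ blk₁ c ≡ 0ℚ
    total₁₁ c c≢blk₁ =
      cong (λ s → s + 0ℚ + 0ℚ) (Σℚ-zero _ λ l → offDiag zero (member c l) (zero≢member c c≢blk₁ l))
      where
      zero≢member : ∀ c → c ≢ blk₁ → ∀ k → zero ≢ member c k
      zero≢member blk₁ c≢blk₁ k = ⊥-elim (c≢blk₁ refl)
      zero≢member blk₂ _ k ()
      zero≢member blk₃ _ k ()

    H-member : ∀ c k → ℕ→ℚ (seq3 h₁ h₂ h₃ a b (member c k)) ≡ H c
    H-member c k = cong ℕ→ℚ (seq3-member h₁ h₂ h₃ c k)

    lineSum-by-block : ∀ c d i j →
      ∑[ l ∈ blk₁ ] O (member c i) (member d j) l
        + (∑[ l ∈ blk₂ ] O (member c i) (member d j) l + ∑[ l ∈ blk₃ ] O (member c i) (member d j) l)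
      ≡ H c * H d
    lineSum-by-block c d i j = begin
      ∑[ l ∈ blk₁ ] O i′ j′ l + (∑[ l ∈ blk₂ ] O i′ j′ l + ∑[ l ∈ blk₃ ] O i′ j′ l)
                                  ≡⟨ Σℚ-blocks (O i′ j′) ⟨
      Σℚ (O i′ j′)                ≡⟨ lineSum i′ j′ ⟩
      ℕ→ℚ (p i′ ℕ.* p j′)         ≡⟨ ℕ→ℚ-homo-* (p i′) (p j′) ⟩
      ℕ→ℚ (p i′) * ℕ→ℚ (p j′)     ≡⟨ cong₂ _*_ (H-member c i) (H-member d j) ⟩
      H c * H d                   ∎
      where
      open ≡-Reasoning
      p = seq3 h₁ h₂ h₃ a b
      i′ = member c i
      j′ = member d j

    total-row : ∀ c d →
      total c d blk₁ + (total c d blk₂ + total c d blk₃) ≡ ℕ→ℚ (size c) * (ℕ→ℚ (size d) * (H c * H d))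
    total-row c d = begin
      total c d blk₁ + (total c d blk₂ + total c d blk₃)
        ≡⟨ Σℚ-distrib-+₃ (Σℚ ∘ S blk₁) (Σℚ ∘ S blk₂) (Σℚ ∘ S blk₃) ⟨
      Σℚ (λ i → Σℚ (S blk₁ i) + (Σℚ (S blk₂ i) + Σℚ (S blk₃ i)))
        ≡⟨ Σℚ-cong (λ i → Σℚ-distrib-+₃ (S blk₁ i) (S blk₂ i) (S blk₃ i)) ⟨
      Σℚ (λ i → Σℚ (λ j → S blk₁ i j + (S blk₂ i j + S blk₃ i j)))
        ≡⟨ Σℚ-cong (λ i → Σℚ-cong (λ j → lineSum-by-block c d i j)) ⟩
      ∑[ i ∈ c ] ∑[ j ∈ d ] (H c * H d)
        ≡⟨ trans (Σℚ-cong {size c} λ i → Σℚ-const (size d) (H c * H d))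
                 (Σℚ-const (size c) (ℕ→ℚ (size d) * (H c * H d))) ⟩
      ℕ→ℚ (size c) * (ℕ→ℚ (size d) * (H c * H d))
        ∎
      where
      open ≡-Reasoning
      S : Block → Fin (size c) → Fin (size d) → ℚ
      S e i j = ∑[ l ∈ e ] O (member c i) (member d j) l

    total-diagonal : ∀ c → ℕ→ℚ (size c) * (H c * H c) ≤ total c c c
    total-diagonal c = begin
      ℕ→ℚ (size c) * (H c * H c)     ≡⟨ Σℚ-const (size c) (H c * H c) ⟨
      ∑[ i ∈ c ] (H c * H c)         ≤⟨ Σℚ-mono-≤ diagonal≤ ⟩
      total c c c                        ∎
      where
      open ℚ.≤-Reasoning
      diagonal≤ : ∀ k → H c * H c ≤ ∑[ j ∈ c ] ∑[ l ∈ c ] O (member c k) j l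
      diagonal≤ k = begin
        H c * H c                  ≡⟨ cong₂ _*_ (H-member c k) (H-member c k) ⟨
        ℕ→ℚ (p k′) * ℕ→ℚ (p k′)    ≡⟨ ℕ→ℚ-homo-* (p k′) (p k′) ⟨
        ℕ→ℚ (p k′ ℕ.* p k′)        ≡⟨ diag k′ ⟨
        O k′ k′ k′                 ≤⟨ term≤Σℚ (λ l → nonneg k′ k′ (member c l)) k ⟩
        ∑[ l ∈ c ] O k′ k′ l       ≤⟨ term≤Σℚ (λ j → Σℚ-nonNeg λ l → nonneg k′ (member c j) (member c l)) k ⟩
        ∑[ j ∈ c ] ∑[ l ∈ c ] O k′ j l ∎
        where
        p = seq3 h₁ h₂ h₃ a b
        k′ = member c k

    blockTotals : Totals (ℕ→ℚ a) (ℕ→ℚ b) (ℕ→ℚ h₁) (ℕ→ℚ h₂) (ℕ→ℚ h₃)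
    blockTotals = record
      { X = total blk₁ blk₂ blk₂
      ; Y = total blk₁ blk₃ blk₃
      ; Z = total blk₁ blk₂ blk₃
      ; U = total blk₂ blk₂ blk₂
      ; V = total blk₂ blk₂ blk₃
      ; W = total blk₂ blk₃ blk₃
      ; T = total blk₃ blk₃ blk₃
      ; X≥0 = total-nonNeg blk₁ blk₂ blk₂
      ; Y≥0 = total-nonNeg blk₁ blk₃ blk₃
      ; Z≥0 = total-nonNeg blk₁ blk₂ blk₃
      ; V≥0 = total-nonNeg blk₂ blk₂ blk₃
      ; W≥0 = total-nonNeg blk₂ blk₃ blk₃
      ; U≥  = total-diagonal blk₂
      ; T≥  = total-diagonal blk₃
      ; row₁₂ = single-head (row blk₁ blk₂ (total₁₁ᵣ blk₂ (λ ())) refl refl)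
      ; row₁₃ = single-head (row blk₁ blk₃ (total₁₁ᵣ blk₃ (λ ())) (total-swap₂₃ blk₁ blk₃ blk₂) refl)
      ; row₂₂ = row blk₂ blk₂ (total-rotate blk₂ blk₂ blk₁) refl refl
      ; row₃₃ = row blk₃ blk₃ (total-rotate blk₃ blk₃ blk₁) (total-rotate blk₃ blk₃ blk₂) refl
      ; row₂₃ = row blk₂ blk₃ (total-rotate blk₂ blk₃ blk₁) (total-swap₂₃ blk₂ blk₃ blk₂) refl
      }
      where
      row : ∀ c d {p q r} → total c d blk₁ ≡ p → total c d blk₂ ≡ q → total c d blk₃ ≡ r →
            p + (q + r) ≡ ℕ→ℚ (size c) * (ℕ→ℚ (size d) * (H c * H d))
      row c d p≡ q≡ r≡ = trans (sym (cong₂ _+_ p≡ (cong₂ _+_ q≡ r≡))) (total-row c d)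
      total₁₁ᵣ : ∀ c → c ≢ blk₁ → total blk₁ c blk₁ ≡ 0ℚ
      total₁₁ᵣ c c≢blk₁ = trans (total-swap₂₃ blk₁ c blk₁) (total₁₁ c c≢blk₁)
      single-head : ∀ {p q} → 0ℚ + p ≡ 1ℚ * q → p ≡ q
      single-head {p} {q} eq = trans (sym (ℚ.+-identityˡ p)) (trans eq (ℚ.*-identityˡ q))

  ROS⇒totals : ∀ {a b h₁ h₂ h₃} → ROS (ℕ.suc (a ℕ.+ b)) (seq3 h₁ h₂ h₃ a b) →
               Totals (ℕ→ℚ a) (ℕ→ℚ b) (ℕ→ℚ h₁) (ℕ→ℚ h₂) (ℕ→ℚ h₃)
  ROS⇒totals R = Aggregation.blockTotals R

  -- From block values to an ROS

  data Pattern : Set where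
    diagonal                                    : Block → Pattern
    ⟨122⟩ ⟨123⟩ ⟨133⟩ ⟨222⟩ ⟨223⟩ ⟨233⟩ ⟨333⟩ : Pattern

  -- The argument is (number of equal index pairs, indices in block 2, indices in block 3); triples
  -- with exactly two equal indices, and impossible signatures, carry no value.
  classify : ℕ × ℕ × ℕ → Maybe Pattern
  classify (3 , 0 , 0) = just (diagonal blk₁)
  classify (3 , 3 , 0) = just (diagonal blk₂)
  classify (3 , 0 , 3) = just (diagonal blk₃)
  classify (0 , 2 , 0) = just ⟨122⟩
  classify (0 , 1 , 1) = just ⟨123⟩
  classify (0 , 0 , 2) = just ⟨133⟩
  classify (0 , 3 , 0) = just ⟨222⟩
  classify (0 , 2 , 1) = just ⟨223⟩
  classify (0 , 1 , 2) = just ⟨233⟩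
  classify (0 , 0 , 3) = just ⟨333⟩
  classify _           = nothing

  in₂ in₃ : Block → ℕ
  in₂ = onBlock 0 1 0
  in₃ = onBlock 0 0 1

  module _ {A B H₁ H₂ H₃ : ℚ} (bv : BlockValues A B H₁ H₂ H₃) (D : Block → ℚ) where
    open BlockValues bv

    patternValue : Pattern → ℚ
    patternValue (diagonal c) = D c
    patternValue ⟨122⟩ = x
    patternValue ⟨123⟩ = z
    patternValue ⟨133⟩ = y
    patternValue ⟨222⟩ = u
    patternValue ⟨223⟩ = v
    patternValue ⟨233⟩ = w
    patternValue ⟨333⟩ = t

    patternValue-nonNeg : (∀ c → 0ℚ ≤ D c) → ∀ p → 0ℚ ≤ patternValue p
    patternValue-nonNeg D≥0 (diagonal c) = D≥0 c
    patternValue-nonNeg D≥0 ⟨122⟩ = x≥0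
    patternValue-nonNeg D≥0 ⟨123⟩ = z≥0
    patternValue-nonNeg D≥0 ⟨133⟩ = y≥0
    patternValue-nonNeg D≥0 ⟨222⟩ = u≥0
    patternValue-nonNeg D≥0 ⟨223⟩ = v≥0
    patternValue-nonNeg D≥0 ⟨233⟩ = w≥0
    patternValue-nonNeg D≥0 ⟨333⟩ = t≥0

    distinctValue : Block → Block → Block → ℚ
    distinctValue c d e =
      maybe′ patternValue 0ℚ (classify (0 , in₂ c ℕ.+ in₂ d ℕ.+ in₂ e , in₃ c ℕ.+ in₃ d ℕ.+ in₃ e))

  -- Σₗ O(i,j,l) for i ≠ j in blocks c and d, when O(i,j,l) = G (block l) except at l = i and l = j,
  -- where it vanishes.
  lineTotal : (A B : ℚ) → (Block → ℚ) → Block → Block → ℚ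
  lineTotal A B G c d = G blk₁ + (A * G blk₂ + B * G blk₃) - (G c + G d)

  module _ {A B H₁ H₂ H₃ : ℚ} where
    open ≡-Reasoning

    lineTotal-distinctValue : (bv : BlockValues A B H₁ H₂ H₃) (D : Block → ℚ) →
      ∀ c d → (c , d) ≢ (blk₁ , blk₁) →
      lineTotal A B (distinctValue bv D c d) c d ≡ onBlock H₁ H₂ H₃ c * onBlock H₁ H₂ H₃ d
    lineTotal-distinctValue
      record { x = x ; y = y ; z = z ; u = u ; v = v ; w = w ; t = t
             ; row₁₂ = row₁₂ ; row₁₃ = row₁₃ ; row₂₂ = row₂₂ ; row₃₃ = row₃₃ ; row₂₃ = row₂₃ } D = λ where
      blk₁ blk₁ ≢ → ⊥-elim (≢ refl)
      blk₁ blk₂ _ → begin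
        0ℚ + (A * x + B * z) - (0ℚ + x)   ≡⟨ solve (A ∷ B ∷ x ∷ z ∷ []) ℚ-ring ⟩
        (A - 1ℚ) * x + B * z              ≡⟨ row₁₂ ⟩
        H₁ * H₂                           ∎
      blk₂ blk₁ _ → begin
        0ℚ + (A * x + B * z) - (x + 0ℚ)   ≡⟨ solve (A ∷ B ∷ x ∷ z ∷ []) ℚ-ring ⟩
        (A - 1ℚ) * x + B * z              ≡⟨ row₁₂ ⟩
        H₁ * H₂                           ≡⟨ ℚ.*-comm H₁ H₂ ⟩
        H₂ * H₁                           ∎
      blk₁ blk₃ _ → begin
        0ℚ + (A * z + B * y) - (0ℚ + y)   ≡⟨ solve (A ∷ B ∷ y ∷ z ∷ []) ℚ-ring ⟩
        A * z + (B - 1ℚ) * y              ≡⟨ row₁₃ ⟩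
        H₁ * H₃                           ∎
      blk₃ blk₁ _ → begin
        0ℚ + (A * z + B * y) - (y + 0ℚ)   ≡⟨ solve (A ∷ B ∷ y ∷ z ∷ []) ℚ-ring ⟩
        A * z + (B - 1ℚ) * y              ≡⟨ row₁₃ ⟩
        H₁ * H₃                           ≡⟨ ℚ.*-comm H₁ H₃ ⟩
        H₃ * H₁                           ∎
      blk₂ blk₂ _ → begin
        x + (A * u + B * v) - (u + u)     ≡⟨ solve (A ∷ B ∷ x ∷ u ∷ v ∷ []) ℚ-ring ⟩
        x + (A - ℕ→ℚ 2) * u + B * v       ≡⟨ row₂₂ ⟩
        H₂ * H₂                           ∎
      blk₃ blk₃ _ → begin
        y + (A * w + B * t) - (t + t)     ≡⟨ solve (A ∷ B ∷ y ∷ w ∷ t ∷ []) ℚ-ring ⟩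
        y + A * w + (B - ℕ→ℚ 2) * t       ≡⟨ row₃₃ ⟩
        H₃ * H₃                           ∎
      blk₂ blk₃ _ → begin
        z + (A * v + B * w) - (v + w)     ≡⟨ solve (A ∷ B ∷ z ∷ v ∷ w ∷ []) ℚ-ring ⟩
        z + (A - 1ℚ) * v + (B - 1ℚ) * w   ≡⟨ row₂₃ ⟩
        H₂ * H₃                           ∎
      blk₃ blk₂ _ → begin
        z + (A * v + B * w) - (w + v)     ≡⟨ solve (A ∷ B ∷ z ∷ v ∷ w ∷ []) ℚ-ring ⟩
        z + (A - 1ℚ) * v + (B - 1ℚ) * w   ≡⟨ row₂₃ ⟩
        H₂ * H₃                           ≡⟨ ℚ.*-comm H₂ H₃ ⟩
        H₃ * H₂                           ∎

  -- O is read off statistics of the index triple that are invariant under permuting it, so the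
  -- symmetry axioms hold by construction.
  module Construction {a b h₁ h₂ h₃ : ℕ} (bv : BlockValues (ℕ→ℚ a) (ℕ→ℚ b) (ℕ→ℚ h₁) (ℕ→ℚ h₂) (ℕ→ℚ h₃)) where
    open Blocks a b
    open import Algebra.Properties.CommutativeSemigroup ℕ.+-commutativeSemigroup
      using (xy∙z≈xz∙y; xy∙z≈zy∙x; xy∙z≈yx∙z)

    private
      N = ℕ.suc (a ℕ.+ b)
      p = seq3 h₁ h₂ h₃ a b

    coincide : Fin N → Fin N → ℕ
    coincide i j = if does (i Fin.≟ j) then 1 else 0

    coincide-refl : ∀ i → coincide i i ≡ 1
    coincide-refl i = cong (if_then 1 else 0) (dec-true (i Fin.≟ i) refl)

    coincide-≢ : ∀ {i j} → i ≢ j → coincide i j ≡ 0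
    coincide-≢ {i} {j} i≢j = cong (if_then 1 else 0) (dec-false (i Fin.≟ j) i≢j)

    coincide-sym : ∀ i j → coincide i j ≡ coincide j i
    coincide-sym i j = by-cases (i Fin.≟ j)
      where
      by-cases : Dec (i ≡ j) → coincide i j ≡ coincide j i
      by-cases (yes i≡j) = cong₂ coincide i≡j (sym i≡j)
      by-cases (no  i≢j) = trans (coincide-≢ i≢j) (sym (coincide-≢ (i≢j ∘ sym)))

    coincidences : Fin N → Fin N → Fin N → ℕ
    coincidences i j l = coincide i j ℕ.+ coincide j l ℕ.+ coincide i l

    count : (Block → ℕ) → Fin N → Fin N → Fin N → ℕ
    count n i j l = n (block i) ℕ.+ n (block j) ℕ.+ n (block l)

    signature : Fin N → Fin N → Fin N → ℕ × ℕ × ℕ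
    signature i j l = coincidences i j l , count in₂ i j l , count in₃ i j l

    signature-swap₁₂ : ∀ i j l → signature i j l ≡ signature j i l
    signature-swap₁₂ i j l = cong₂ _,_
      (trans (cong (λ n → n ℕ.+ coincide j l ℕ.+ coincide i l) (coincide-sym i j))
             (xy∙z≈xz∙y (coincide j i) (coincide j l) (coincide i l)))
      (cong₂ _,_ (count-swap in₂) (count-swap in₃))
      where
      count-swap : ∀ n → count n i j l ≡ count n j i l
      count-swap n = xy∙z≈yx∙z (n (block i)) (n (block j)) (n (block l))

    signature-swap₂₃ : ∀ i j l → signature i j l ≡ signature i l j
    signature-swap₂₃ i j l = cong₂ _,_
      (trans (cong (λ n → coincide i j ℕ.+ n ℕ.+ coincide i l) (coincide-sym j l))
             (xy∙z≈zy∙x (coincide i j) (coincide l j) (coincide i l)))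
      (cong₂ _,_ (count-swap in₂) (count-swap in₃))
      where
      count-swap : ∀ n → count n i j l ≡ count n i l j
      count-swap n = xy∙z≈xz∙y (n (block i)) (n (block j)) (n (block l))

    D : Block → ℚ
    D c = ℕ→ℚ (onBlock h₁ h₂ h₃ c ℕ.* onBlock h₁ h₂ h₃ c)

    value : ℕ × ℕ × ℕ → ℚ
    value s = maybe′ (patternValue bv D) 0ℚ (classify s)

    O : Fin N → Fin N → Fin N → ℚ
    O i j l = value (signature i j l)

    O-nonNeg : ∀ i j l → 0ℚ ≤ O i j l
    O-nonNeg i j l = maybe-nonNeg (classify (signature i j l))
      where
      maybe-nonNeg : ∀ m → 0ℚ ≤ maybe′ (patternValue bv D) 0ℚ m
      maybe-nonNeg (just π) =
        patternValue-nonNeg bv D (λ c → ℕ→ℚ-nonNeg (onBlock h₁ h₂ h₃ c ℕ.* onBlock h₁ h₂ h₃ c)) π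
      maybe-nonNeg nothing  = ℚ.≤-refl

    O-diagonal : ∀ i → O i i i ≡ ℕ→ℚ (p i ℕ.* p i)
    O-diagonal i = begin
      O i i i
        ≡⟨ cong (λ n → value (n ℕ.+ n ℕ.+ n , count in₂ i i i , count in₃ i i i)) (coincide-refl i) ⟩
      value (3 , count in₂ i i i , count in₃ i i i)
        ≡⟨ by-block (block i) ⟩
      D (block i)
        ≡⟨ cong (λ h → ℕ→ℚ (h ℕ.* h)) (seq3-block h₁ h₂ h₃ i) ⟨
      ℕ→ℚ (p i ℕ.* p i)
        ∎
      where
      open ≡-Reasoning
      by-block : ∀ c → value (3 , in₂ c ℕ.+ in₂ c ℕ.+ in₂ c , in₃ c ℕ.+ in₃ c ℕ.+ in₃ c) ≡ D c
      by-block blk₁ = refl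
      by-block blk₂ = refl
      by-block blk₃ = refl

    O-offDiagonal : ∀ {i j} → i ≢ j → O i i j ≡ 0ℚ
    O-offDiagonal {i} {j} i≢j =
      cong₂ (λ m n → value (m ℕ.+ n ℕ.+ n , count in₂ i i j , count in₃ i i j)) (coincide-refl i) (coincide-≢ i≢j)

    O-repeated₁₃ : ∀ {i j} → i ≢ j → O i j i ≡ 0ℚ
    O-repeated₁₃ {i} {j} i≢j rewrite coincide-≢ i≢j | coincide-≢ (i≢j ∘ sym) | coincide-refl i = refl

    O-repeated₂₃ : ∀ {i j} → i ≢ j → O i j j ≡ 0ℚ
    O-repeated₂₃ {i} {j} i≢j rewrite coincide-≢ i≢j | coincide-refl j = refl

    O-distinct : ∀ {i j l} → i ≢ j → j ≢ l → i ≢ l → O i j l ≡ distinctValue bv D (block i) (block j) (block l)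
    O-distinct i≢j j≢l i≢l rewrite coincide-≢ i≢j | coincide-≢ j≢l | coincide-≢ i≢l = refl

    O-lineSum : ∀ i j → Σℚ (O i j) ≡ ℕ→ℚ (p i ℕ.* p j)
    O-lineSum i j = by-cases (i Fin.≟ j)
      where
      open ≡-Reasoning
      by-cases : Dec (i ≡ j) → Σℚ (O i j) ≡ ℕ→ℚ (p i ℕ.* p j)
      by-cases (yes refl) = trans (Σℚ-single (O i i) i (λ l l≢i → O-offDiagonal (l≢i ∘ sym))) (O-diagonal i)
      by-cases (no i≢j)   = begin
        Σℚ (O i j)                              ≡⟨ Σℚ-off-pair i≢j (O-repeated₁₃ i≢j) (O-repeated₂₃ i≢j)
                                                     (λ l l≢i l≢j → O-distinct i≢j (l≢j ∘ sym) (l≢i ∘ sym)) ⟩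
        Σℚ (G ∘ block) - (G (block i) + G (block j))
                                                ≡⟨ cong (_- (G (block i) + G (block j))) (Σℚ-by-block G) ⟩
        lineTotal (ℕ→ℚ a) (ℕ→ℚ b) G (block i) (block j)
                                                ≡⟨ lineTotal-distinctValue bv D (block i) (block j) not-both-blk₁ ⟩
        H (block i) * H (block j)               ≡⟨ cong₂ _*_ (H-block i) (H-block j) ⟨
        ℕ→ℚ (p i) * ℕ→ℚ (p j)                   ≡⟨ ℕ→ℚ-homo-* (p i) (p j) ⟨
        ℕ→ℚ (p i ℕ.* p j)                       ∎
        where
        G : Block → ℚ
        G = distinctValue bv D (block i) (block j)
        H : Block → ℚ
        H = onBlock (ℕ→ℚ h₁) (ℕ→ℚ h₂) (ℕ→ℚ h₃)
        H-block : ∀ k → ℕ→ℚ (p k) ≡ H (block k)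
        H-block k = trans (cong ℕ→ℚ (seq3-block h₁ h₂ h₃ k)) (onBlock-map ℕ→ℚ (block k))
        not-both-blk₁ : (block i , block j) ≢ (blk₁ , blk₁)
        not-both-blk₁ eq =
          i≢j (trans (block≡blk₁⇒zero i (cong proj₁ eq)) (sym (block≡blk₁⇒zero j (cong proj₂ eq))))

    ros : ROS N p
    ros = record
      { O       = O
      ; sym₁₂   = λ i j l → cong value (signature-swap₁₂ i j l)
      ; sym₂₃   = λ i j l → cong value (signature-swap₂₃ i j l)
      ; nonneg  = O-nonNeg
      ; lineSum = O-lineSum
      ; diag    = O-diagonal
      ; offDiag = λ i j → O-offDiagonal
      }

  blockValues⇒ROS : ∀ {a b h₁ h₂ h₃} → BlockValues (ℕ→ℚ a) (ℕ→ℚ b) (ℕ→ℚ h₁) (ℕ→ℚ h₂) (ℕ→ℚ h₃) →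
                    ROS (ℕ.suc (a ℕ.+ b)) (seq3 h₁ h₂ h₃ a b)
  blockValues⇒ROS bv = Construction.ros bv

open import Defs
open import Data.Nat using (ℕ; suc; _+_; _≤_; z≤n; s≤s)
import Data.Nat.Properties as ℕ
open import Data.Integer using (ℤ; +_; _*_; _-_) renaming (_+_ to _+ℤ_; _≤_ to _≤ℤ_)
open import Data.Product using (_×_; proj₂)
import Data.Rational.Properties as ℚ
open import Function.Bundles using (_⇔_; mk⇔; Equivalence)
open Criterion

mainTheorem7 : (a b h₁ h₂ h₃ : ℕ) → 3 ≤ a → 3 ≤ b → 1 ≤ h₁ → 1 ≤ h₂ → 1 ≤ h₃ →
  (ROS (suc (a + b)) (seq3 h₁ h₂ h₃ a b) ⇔
    ((+ h₁ ≤ℤ (+ a - + 1) * + h₂ +ℤ + b * + h₃)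
    × (+ h₁ ≤ℤ (+ b - + 1) * + h₃ +ℤ + a * + h₂)
    × (+ a * + h₁ * + h₂ - + b * + h₁ * + h₃ ≤ℤ + a * (+ a - + 1) * + h₂ * + h₂)
    × (+ b * + h₁ * + h₃ - + a * + h₁ * + h₂ ≤ℤ + b * (+ b - + 1) * + h₃ * + h₃)
    × (+ a * + b * + h₂ * + h₃ - + 2 * + a * + h₁ * + h₂ +ℤ + b * + h₁ * + h₃
        ≤ℤ + a * (+ a - + 1) * + h₂ * + h₂ +ℤ + b * (+ b - + 1) * + h₃ * + h₃)
    × (+ a * + b * + h₂ * + h₃ - + 2 * + b * + h₁ * + h₃ +ℤ + a * + h₁ * + h₂
        ≤ℤ + a * (+ a - + 1) * + h₂ * + h₂ +ℤ + b * (+ b - + 1) * + h₃ * + h₃)))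
mainTheorem7 a b h₁ h₂ h₃ 3≤a 3≤b 1≤h₁ 1≤h₂ 1≤h₃ = mk⇔
  (λ R → Equivalence.from integer⇔rational
           (feasible⇒conditions 0<A 0<B 0<H₂ 0<H₃ (totals⇒feasible (ROS⇒totals R))))
  (λ conditions → blockValues⇒ROS (feasible⇒blockValues 0<A 0<B 0<A-1 0<B-1 0<A-2 0<B-2
     (proj₂ (proj₂ (conditions⇒feasible (ℚ.<⇒≤ 0<A) (ℚ.<⇒≤ 0<B) (ℚ.<⇒≤ 0<A-1) (ℚ.<⇒≤ 0<B-1)
                                          (ℚ.<⇒≤ 0<H₁) (ℚ.<⇒≤ 0<H₂) (ℚ.<⇒≤ 0<H₃)
                                          (Equivalence.to integer⇔rational conditions))))))
  where
  integer⇔rational = Conditionsℤ⇔ℚ a b h₁ h₂ h₃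
  0<A   = 0<ℕ→ℚ (ℕ.<-≤-trans (s≤s z≤n) 3≤a)
  0<B   = 0<ℕ→ℚ (ℕ.<-≤-trans (s≤s z≤n) 3≤b)
  0<A-1 = 0<ℕ→ℚ-diff (ℕ.<-≤-trans (s≤s (s≤s z≤n)) 3≤a)
  0<B-1 = 0<ℕ→ℚ-diff (ℕ.<-≤-trans (s≤s (s≤s z≤n)) 3≤b)
  0<A-2 = 0<ℕ→ℚ-diff 3≤a
  0<B-2 = 0<ℕ→ℚ-diff 3≤b
  0<H₁  = 0<ℕ→ℚ 1≤h₁
  0<H₂  = 0<ℕ→ℚ 1≤h₂
  0<H₃  = 0<ℕ→ℚ 1≤h₃
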